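{- Let $(G=(V,E),c,\omega,\chi,k)$ be an instance of LS Max $c$-Cut. Then for every inclusion-minimal improving $k$-flip $\chi'$ for $\chi$, the vertex set $D_{\mathrm{flip}}(\chi,\chi')$ induces a connected subgraph of $G$.
   Context: An instance of LS Max $c$-Cut consists of a graph $G=(V,E)$, $c\in\mathbb{N}$, $\omega:E\to\mathbb{Q}$, a $c$-coloring $\chi:V\to\{1,\dots,c\}$ and $k\in\mathbb{N}$. $D_{\mathrm{flip}}(\chi,\chi')=\{v:\chi(v)\neq\chi'(v)\}$, $d_{\mathrm{flip}}=|D_{\mathrm{flip}}|$, $E(\chi)=\{\{u,v\}\in E:\chi(u)\neq\chi(v)\}$, $\omega(F)$ the total weight of $F$. $\chi'$ is an improving $k$-neighbor of $\chi$ if $d_{\mathrm{flip}}(\chi,\chi')\le k$ and $\omega(E(\chi'))>\omega(E(\chi))$; it is an inclusion-minimal improving $k$-flip for $\chi$ if moreover there is no improving $k$-neighbor $\tilde\chi$ of $\chi$ with $D_{\mathrm{flip}}(\chi,\tilde\chi)\subsetneq D_{\mathrm{flip}}(\chi,\chi')$. -}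

module Defs where

open import Data.Nat using (ℕ; zero; suc; _≤_)
open import Data.Fin using (Fin; toℕ; _≟_)
open import Data.Fin.Subset using (Subset; _∈_; _⊂_; ∣_∣)
open import Data.Bool using (Bool; true; false; if_then_else_; not; _∧_)
open import Data.Vec using (tabulate)
open import Data.Rational using (ℚ; 0ℚ; _+_; _<_)
open import Data.Product using (_×_; Σ)
open import Relation.Nullary using (¬_)
open import Relation.Nullary.Decidable using (⌊_⌋)
open import Relation.Binary.PropositionalEquality using (_≡_)
open import Relation.Binary.Construct.Closure.ReflexiveTransitive using (Star)
import Data.Nat as ℕ

record Graph (n : ℕ) : Set where
  field
    adj   : Fin n → Fin n → Bool
    sym   : ∀ u v → adj u v ≡ adj v u
    irrefl : ∀ v → adj v v ≡ false
open Graph public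

-- Edge {u,v} is represented by the ordered pair (u , v) with u < v.
isEdge : ∀ {n} → Graph n → Fin n → Fin n → Bool
isEdge G u v = ⌊ toℕ u ℕ.<? toℕ v ⌋ ∧ adj G u v

-- Weights ω : E → ℚ, given as a function on pairs; only its values on
-- edges (u , v) with u < v are ever used.
Weight : ℕ → Set
Weight n = Fin n → Fin n → ℚ

Coloring : ℕ → ℕ → Set
Coloring n c = Fin n → Fin c

sumFin : ∀ {n} → (Fin n → ℚ) → ℚ
sumFin {zero}  f = 0ℚ
sumFin {suc n} f = f Fin.zero + sumFin (λ i → f (Fin.suc i))
  where import Data.Fin as Fin

cutWeight : ∀ {n c} → Graph n → Weight n → Coloring n c → ℚ
cutWeight G ω χ =
  sumFin λ u → sumFin λ v →
    if isEdge G u v ∧ not ⌊ χ u ≟ χ v ⌋ then ω u v else 0ℚ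

Dflip : ∀ {n c} → Coloring n c → Coloring n c → Subset n
Dflip χ χ' = tabulate λ v → not ⌊ χ v ≟ χ' v ⌋

dflip : ∀ {n c} → Coloring n c → Coloring n c → ℕ
dflip χ χ' = ∣ Dflip χ χ' ∣

ImprovingNeighbor : ∀ {n c} → Graph n → Weight n → ℕ →
                    Coloring n c → Coloring n c → Set
ImprovingNeighbor G ω k χ χ' =
  dflip χ χ' ≤ k × cutWeight G ω χ < cutWeight G ω χ'

InclMinImprovingFlip : ∀ {n c} → Graph n → Weight n → ℕ →
                       Coloring n c → Coloring n c → Set
InclMinImprovingFlip {n} {c} G ω k χ χ' =
  ImprovingNeighbor G ω k χ χ' ×
  (∀ (χ̃ : Coloring n c) → ImprovingNeighbor G ω k χ χ̃ →
     ¬ (Dflip χ χ̃ ⊂ Dflip χ χ'))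

InducedEdge : ∀ {n} → Graph n → Subset n → Fin n → Fin n → Set
InducedEdge G S u v = u ∈ S × v ∈ S × adj G u v ≡ true

InducesConnected : ∀ {n} → Graph n → Subset n → Set
InducesConnected G S = ∀ u v → u ∈ S → v ∈ S → Star (InducedEdge G S) u v

-- Suppose D = D_flip(χ, χ') were disconnected, and let R be the part of D reachable from some
-- u ∈ D inside D. No edge of G joins R to D ∖ R, so flipping only R and flipping only D ∖ R
-- split the cut: ω(E(χ')) + ω(E(χ)) = ω(E(χ_R)) + ω(E(χ_{D∖R})). As χ' improves on χ, one of
-- the two partial flips improves on χ as well, and its flip set is a proper subset of D.
module Submission where

open import Data.Nat using (ℕ; zero; suc; s≤s)
open import Data.Nat.Properties using (≤-trans; ≤-reflexive; +-suc; +-monoʳ-≤; m≤m+n; <⇒≱)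
open import Data.Fin using (Fin; zero; suc; toℕ; _≟_)
open import Data.Fin.Subset using (Subset; _∈_; _∉_; _⊆_; _⊂_; ∣_∣; _∪_; _∩_; ∁; ⁅_⁆)
open import Data.Fin.Subset.Properties
  using (_∈?_; _⊂?_; ∣p∣≤n; p⊂q⇒∣p∣<∣q∣; p⊆q⇒∣p∣≤∣q∣; p⊆p∪q; x∈p∪q⁺; x∈p∪q⁻; x∈p∩q⁺; x∈p∩q⁻;
         x∈⁅x⁆; x∈⁅y⁆⇒x≡y; x∈p⇒x∉∁p; x∉p⇒x∈∁p)
open import Data.Fin.Properties using (any?)
open import Data.Bool using (Bool; true; false; if_then_else_; not; _∧_)
import Data.Bool as Bool
import Data.Nat as ℕ
open import Data.Bool.Properties using (∧-zeroʳ; ¬-not)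
open import Data.Vec using (tabulate)
open import Data.Vec.Properties using (lookup∘tabulate; lookup⇒[]=; []=⇒lookup)
open import Data.Rational using (ℚ; 0ℚ; _+_; _<_; _<?_)
open import Data.Rational.Properties
  using (+-comm; +-0-commutativeMonoid; +-mono-≤; +-monoˡ-<; ≮⇒≥; <-≤-trans; <-irrefl)
open import Algebra.Bundles using (CommutativeMonoid)
open import Algebra.Properties.CommutativeSemigroup
  (CommutativeMonoid.commutativeSemigroup +-0-commutativeMonoid) using (interchange)
open import Data.Product using (_×_; _,_; proj₂; ∃)
open import Data.Sum using (_⊎_; inj₁; inj₂)
open import Level using (Level)
open import Function using (_∘_)
open import Relation.Unary using (Pred; Decidable)
open import Relation.Nullary using (¬_; Dec; yes; no; does; contradiction)
open import Relation.Nullary.Decidable using (⌊_⌋; dec-true; dec-false; isYes≗does; decidable-stable; _×-dec_)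
open import Relation.Binary.PropositionalEquality
  using (_≡_; _≢_; refl; sym; trans; cong; cong₂; subst; module ≡-Reasoning)
open import Relation.Binary.Construct.Closure.ReflexiveTransitive using (Star; ε; _◅_; _◅◅_)
open import Defs hiding (sym)

private
  variable
    ℓ : Level
    n c : ℕ
    x y : Fin n

∈-tabulate⁺ : {f : Fin n → Bool} → f x ≡ true → x ∈ tabulate f
∈-tabulate⁺ {x = x} {f} fx = lookup⇒[]= x (tabulate f) (trans (lookup∘tabulate f x) fx)

∈-tabulate⁻ : {f : Fin n → Bool} → x ∈ tabulate f → f x ≡ true
∈-tabulate⁻ {x = x} {f} x∈ = trans (sym (lookup∘tabulate f x)) ([]=⇒lookup x∈)

subsetOf : {P : Pred (Fin n) ℓ} → Decidable P → Subset n
subsetOf P? = tabulate (λ x → does (P? x))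

does-true⇒ : {A : Set ℓ} (a? : Dec A) → does a? ≡ true → A
does-true⇒ (yes a) _ = a

∈-subsetOf⁺ : {P : Pred (Fin n) ℓ} (P? : Decidable P) → P x → x ∈ subsetOf P?
∈-subsetOf⁺ {x = x} P? Px = ∈-tabulate⁺ (dec-true (P? x) Px)

∈-subsetOf⁻ : {P : Pred (Fin n) ℓ} (P? : Decidable P) → x ∈ subsetOf P? → P x
∈-subsetOf⁻ {x = x} P? x∈ = does-true⇒ (P? x) (∈-tabulate⁻ x∈)

-- Each round that does not stop adds an element, so n + 1 rounds reach a fixed point.
module Closure (grow : Subset n → Subset n) (⊆-grow : ∀ S → S ⊆ grow S) where

  iterate : ℕ → Subset n → Subset n
  iterate zero       S = S
  iterate (suc fuel) S with S ⊂? grow S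
  ... | yes _ = iterate fuel (grow S)
  ... | no  _ = S

  closure : Subset n → Subset n
  closure = iterate (suc n)

  ⊆-iterate : ∀ fuel S → S ⊆ iterate fuel S
  ⊆-iterate zero       S x∈S = x∈S
  ⊆-iterate (suc fuel) S x∈S with S ⊂? grow S
  ... | yes _ = ⊆-iterate fuel (grow S) (⊆-grow S x∈S)
  ... | no  _ = x∈S

  iterate-preserves : (P : Subset n → Set ℓ) → (∀ S → P S → P (grow S)) →
                      ∀ fuel S → P S → P (iterate fuel S)
  iterate-preserves P P-grow zero       S PS = PS
  iterate-preserves P P-grow (suc fuel) S PS with S ⊂? grow S
  ... | yes _ = iterate-preserves P P-grow fuel (grow S) (P-grow S PS)
  ... | no  _ = PS

  ⊄-grow⇒closed : ∀ S → ¬ (S ⊂ grow S) → grow S ⊆ S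
  ⊄-grow⇒closed S S⊄ {x} x∈grow with x ∈? S
  ... | yes x∈S = x∈S
  ... | no  x∉S = contradiction ((λ {_} → ⊆-grow S) , x , x∈grow , x∉S) S⊄

  iterate-closed : ∀ fuel S → n ℕ.< fuel ℕ.+ ∣ S ∣ →
                   grow (iterate fuel S) ⊆ iterate fuel S
  iterate-closed zero       S n<∣S∣ = contradiction (∣p∣≤n S) (<⇒≱ n<∣S∣)
  iterate-closed (suc fuel) S n<    with S ⊂? grow S
  ... | no  S⊄ = ⊄-grow⇒closed S S⊄
  ... | yes S⊂ = iterate-closed fuel (grow S)
    (≤-trans n< (≤-trans (≤-reflexive (sym (+-suc fuel ∣ S ∣)))
                         (+-monoʳ-≤ fuel (p⊂q⇒∣p∣<∣q∣ S⊂))))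

  ⊆-closure : ∀ S → S ⊆ closure S
  ⊆-closure = ⊆-iterate (suc n)

  closure-preserves : (P : Subset n → Set ℓ) → (∀ S → P S → P (grow S)) →
                      ∀ S → P S → P (closure S)
  closure-preserves P P-grow = iterate-preserves P P-grow (suc n)

  closure-closed : ∀ S → grow (closure S) ⊆ closure S
  closure-closed S = iterate-closed (suc n) S (s≤s (m≤m+n n ∣ S ∣))

module _ (G : Graph n) (D : Subset n) where

  adjacentFrom? : (S : Subset n) → Decidable (λ y → ∃ λ x → x ∈ S × adj G x y ≡ true)
  adjacentFrom? S y = any? (λ x → x ∈? S ×-dec adj G x y Bool.≟ true)

  neighbours : Subset n → Subset n
  neighbours S = subsetOf (adjacentFrom? S)

  growInside : Subset n → Subset n
  growInside S = S ∪ (D ∩ neighbours S)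

  open Closure growInside (λ S → p⊆p∪q (D ∩ neighbours S))

  component : Fin n → Subset n
  component u = closure ⁅ u ⁆

  ReachableInside : Fin n → Fin n → Set
  ReachableInside u x = x ∈ D × Star (InducedEdge G D) u x

  u∈component : (u : Fin n) → u ∈ component u
  u∈component u = ⊆-closure ⁅ u ⁆ (x∈⁅x⁆ u)

  component-reachable : (u : Fin n) → u ∈ D → x ∈ component u → ReachableInside u x
  component-reachable u u∈D = closure-preserves Invariant growInside-invariant ⁅ u ⁆ singleton
    where
    Invariant : Subset n → Set
    Invariant S = ∀ {x} → x ∈ S → ReachableInside u x

    singleton : Invariant ⁅ u ⁆
    singleton x∈⁅u⁆ with x∈⁅y⁆⇒x≡y u x∈⁅u⁆
    ... | refl = u∈D , ε

    growInside-invariant : ∀ S → Invariant S → Invariant (growInside S)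
    growInside-invariant S inv {y} y∈ with x∈p∪q⁻ S (D ∩ neighbours S) y∈
    ... | inj₁ y∈S = inv y∈S
    ... | inj₂ y∈D∩N with x∈p∩q⁻ D (neighbours S) y∈D∩N
    ...   | y∈D , y∈N with ∈-subsetOf⁻ (adjacentFrom? S) y∈N
    ...     | x , x∈S , x~y with inv x∈S
    ...       | x∈D , u⇝x = y∈D , u⇝x ◅◅ (x∈D , y∈D , x~y) ◅ ε

  component-closed : (u : Fin n) → x ∈ component u → y ∈ D → adj G x y ≡ true →
                     y ∈ component u
  component-closed u x∈R y∈D x~y =
    closure-closed ⁅ u ⁆
      (x∈p∪q⁺ (inj₂ (x∈p∩q⁺ (y∈D , ∈-subsetOf⁺ (adjacentFrom? _) (_ , x∈R , x~y)))))

  component-separated : (u : Fin n) → x ∈ component u → y ∉ component u → y ∈ D →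
                        adj G x y ≡ false
  component-separated u x∈R y∉R y∈D = ¬-not (y∉R ∘ component-closed u x∈R y∈D)

module _ {χ χ' : Coloring n c} where

  ∈-Dflip⁺ : χ x ≢ χ' x → x ∈ Dflip χ χ'
  ∈-Dflip⁺ {x = x} χx≢χ'x =
    ∈-tabulate⁺ (cong not (trans (isYes≗does (χ x ≟ χ' x)) (dec-false (χ x ≟ χ' x) χx≢χ'x)))

  ∈-Dflip⁻ : x ∈ Dflip χ χ' → χ x ≢ χ' x
  ∈-Dflip⁻ {x = x} x∈D with χ x ≟ χ' x | ∈-tabulate⁻ x∈D
  ... | yes _       | ()
  ... | no χx≢χ'x | _ = χx≢χ'x

  ∉-Dflip⁻ : x ∉ Dflip χ χ' → χ x ≡ χ' x
  ∉-Dflip⁻ {x = x} x∉D = decidable-stable (χ x ≟ χ' x) (x∉D ∘ ∈-Dflip⁺)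

-- Opaque, so that unification can recover S, χ and χ' from flipOn S χ χ' x.
opaque
  flipOn : Subset n → Coloring n c → Coloring n c → Coloring n c
  flipOn S χ χ' x = if does (x ∈? S) then χ' x else χ x

module _ {S : Subset n} {χ χ' : Coloring n c} where

  opaque
    unfolding flipOn

    flipOn-∈ : x ∈ S → flipOn S χ χ' x ≡ χ' x
    flipOn-∈ {x = x} x∈S = cong (if_then χ' x else χ x) (dec-true (x ∈? S) x∈S)

    flipOn-∉ : x ∉ S → flipOn S χ χ' x ≡ χ x
    flipOn-∉ {x = x} x∉S = cong (if_then χ' x else χ x) (dec-false (x ∈? S) x∉S)

  flipOn-∉Dflip : x ∉ Dflip χ χ' → flipOn S χ χ' x ≡ χ x
  flipOn-∉Dflip {x = x} x∉D with x ∈? S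
  ... | yes x∈S = trans (flipOn-∈ x∈S) (sym (∉-Dflip⁻ x∉D))
  ... | no  x∉S = flipOn-∉ x∉S

  ∉-Dflip-flipOn : x ∉ S → x ∉ Dflip χ (flipOn S χ χ')
  ∉-Dflip-flipOn x∉S x∈ = ∈-Dflip⁻ x∈ (sym (flipOn-∉ x∉S))

  Dflip-flipOn-⊆ : Dflip χ (flipOn S χ χ') ⊆ Dflip χ χ'
  Dflip-flipOn-⊆ {x} x∈ with x ∈? S
  ... | yes x∈S = ∈-Dflip⁺ (subst (χ x ≢_) (flipOn-∈ x∈S) (∈-Dflip⁻ x∈))
  ... | no  x∉S = contradiction x∈ (∉-Dflip-flipOn x∉S)

  dflip-flipOn-≤ : dflip χ (flipOn S χ χ') ℕ.≤ dflip χ χ'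
  dflip-flipOn-≤ = p⊆q⇒∣p∣≤∣q∣ Dflip-flipOn-⊆

  Dflip-flipOn-⊂ : x ∈ Dflip χ χ' → x ∉ S → Dflip χ (flipOn S χ χ') ⊂ Dflip χ χ'
  Dflip-flipOn-⊂ {x = x} x∈D x∉S =
    (λ {_} → Dflip-flipOn-⊆) , x , x∈D , ∉-Dflip-flipOn x∉S

sumFin-+-cong : {f g h k : Fin n → ℚ} → (∀ i → f i + g i ≡ h i + k i) →
                sumFin f + sumFin g ≡ sumFin h + sumFin k
sumFin-+-cong {zero}  eq = refl
sumFin-+-cong {suc n} {f} {g} {h} {k} eq = begin
  (f zero + sumFin (f ∘ suc)) + (g zero + sumFin (g ∘ suc))
    ≡⟨ interchange (f zero) _ (g zero) _ ⟩
  (f zero + g zero) + (sumFin (f ∘ suc) + sumFin (g ∘ suc))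
    ≡⟨ cong₂ _+_ (eq zero) (sumFin-+-cong (eq ∘ suc)) ⟩
  (h zero + k zero) + (sumFin (h ∘ suc) + sumFin (k ∘ suc))
    ≡⟨ interchange (h zero) (k zero) _ _ ⟩
  (h zero + sumFin (h ∘ suc)) + (k zero + sumFin (k ∘ suc))
    ∎
  where open ≡-Reasoning

module _ (G : Graph n) (ω : Weight n) where

  edgeWeight : Coloring n c → Fin n → Fin n → ℚ
  edgeWeight ψ x y = if isEdge G x y ∧ not ⌊ ψ x ≟ ψ y ⌋ then ω x y else 0ℚ

  edgeWeight-cong : {ψ φ : Coloring n c} (x y : Fin n) → ψ x ≡ φ x → ψ y ≡ φ y →
                    edgeWeight ψ x y ≡ edgeWeight φ x y
  edgeWeight-cong x y = cong₂ (λ a b → if isEdge G x y ∧ not ⌊ a ≟ b ⌋ then ω x y else 0ℚ)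

  edgeWeight-nonadjacent : (ψ : Coloring n c) (x y : Fin n) → adj G x y ≡ false →
                           edgeWeight ψ x y ≡ 0ℚ
  edgeWeight-nonadjacent ψ x y x≁y =
    cong (λ e → if e ∧ not ⌊ ψ x ≟ ψ y ⌋ then ω x y else 0ℚ)
         (trans (cong (⌊ toℕ x ℕ.<? toℕ y ⌋ ∧_) x≁y) (∧-zeroʳ _))

  module Exchange (ψ₁ ψ₂ φ₁ φ₂ : Coloring n c) where

    Straight Crossed : Fin n → Set
    Straight x = φ₁ x ≡ ψ₁ x × φ₂ x ≡ ψ₂ x
    Crossed  x = φ₁ x ≡ ψ₂ x × φ₂ x ≡ ψ₁ x

    Exchangeable : Fin n → Fin n → Set
    Exchangeable x y = (Straight x × Straight y) ⊎ (Crossed x × Crossed y) ⊎ adj G x y ≡ false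

    Exchangeable-sym : Exchangeable x y → Exchangeable y x
    Exchangeable-sym (inj₁ (sx , sy))        = inj₁ (sy , sx)
    Exchangeable-sym (inj₂ (inj₁ (cx , cy))) = inj₂ (inj₁ (cy , cx))
    Exchangeable-sym {x = x} {y} (inj₂ (inj₂ x≁y)) = inj₂ (inj₂ (trans (Graph.sym G y x) x≁y))

    edgeWeight-exchange : ∀ x y → Exchangeable x y →
      edgeWeight ψ₁ x y + edgeWeight ψ₂ x y ≡ edgeWeight φ₁ x y + edgeWeight φ₂ x y
    edgeWeight-exchange x y (inj₁ ((s₁x , s₂x) , (s₁y , s₂y))) =
      sym (cong₂ _+_ (edgeWeight-cong x y s₁x s₁y) (edgeWeight-cong x y s₂x s₂y))
    edgeWeight-exchange x y (inj₂ (inj₁ ((c₁x , c₂x) , (c₁y , c₂y)))) =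
      trans (+-comm (edgeWeight ψ₁ x y) _)
            (sym (cong₂ _+_ (edgeWeight-cong x y c₁x c₁y) (edgeWeight-cong x y c₂x c₂y)))
    edgeWeight-exchange x y (inj₂ (inj₂ x≁y)) =
      trans (cong₂ _+_ (nonadjacent ψ₁) (nonadjacent ψ₂))
            (sym (cong₂ _+_ (nonadjacent φ₁) (nonadjacent φ₂)))
      where
      nonadjacent : (ψ : Coloring n c) → edgeWeight ψ x y ≡ 0ℚ
      nonadjacent ψ = edgeWeight-nonadjacent ψ x y x≁y

    cutWeight-exchange : (∀ x y → Exchangeable x y) →
      cutWeight G ω ψ₁ + cutWeight G ω ψ₂ ≡ cutWeight G ω φ₁ + cutWeight G ω φ₂
    cutWeight-exchange exch =
      sumFin-+-cong (λ x → sumFin-+-cong (λ y → edgeWeight-exchange x y (exch x y)))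

-- On an edge leaving S, the endpoint outside S is outside D, so it is coloured alike by all four.
cutWeight-flipOn-split : (G : Graph n) (ω : Weight n) {χ χ' : Coloring n c} (S : Subset n) →
  (∀ {x y} → x ∈ S → y ∉ S → y ∈ Dflip χ χ' → adj G x y ≡ false) →
  cutWeight G ω χ' + cutWeight G ω χ ≡
  cutWeight G ω (flipOn S χ χ') + cutWeight G ω (flipOn (∁ S) χ χ')
cutWeight-flipOn-split G ω {χ} {χ'} S separated = cutWeight-exchange exchangeable
  where
  open Exchange G ω χ' χ (flipOn S χ χ') (flipOn (∁ S) χ χ')

  straight : x ∈ S ⊎ x ∉ Dflip χ χ' → Straight x
  straight (inj₁ x∈S) = flipOn-∈ x∈S , flipOn-∉ (x∈p⇒x∉∁p x∈S)
  straight (inj₂ x∉D) = trans (flipOn-∉Dflip x∉D) (∉-Dflip⁻ x∉D) , flipOn-∉Dflip x∉D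

  crossed : x ∉ S → Crossed x
  crossed x∉S = flipOn-∉ x∉S , flipOn-∈ (x∉p⇒x∈∁p x∉S)

  across : x ∈ S → y ∉ S → Exchangeable x y
  across {y = y} x∈S y∉S with y ∈? Dflip χ χ'
  ... | no  y∉D = inj₁ (straight (inj₁ x∈S) , straight (inj₂ y∉D))
  ... | yes y∈D = inj₂ (inj₂ (separated x∈S y∉S y∈D))

  byMembership : Dec (x ∈ S) → Dec (y ∈ S) → Exchangeable x y
  byMembership (yes x∈S) (yes y∈S) = inj₁ (straight (inj₁ x∈S) , straight (inj₁ y∈S))
  byMembership (no  x∉S) (no  y∉S) = inj₂ (inj₁ (crossed x∉S , crossed y∉S))
  byMembership (yes x∈S) (no  y∉S) = across x∈S y∉S
  byMembership (no  x∉S) (yes y∈S) = Exchangeable-sym (across y∈S x∉S)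

  exchangeable : ∀ x y → Exchangeable x y
  exchangeable x y = byMembership (x ∈? S) (y ∈? S)

+-<⇒<⊎< : {p q r s : ℚ} → p + q < r + s → p < r ⊎ q < s
+-<⇒<⊎< {p} {q} {r} {s} p+q<r+s with p <? r | q <? s
... | yes p<r | _       = inj₁ p<r
... | no  _   | yes q<s = inj₂ q<s
... | no  p≮r | no  q≮s =
  contradiction (<-≤-trans p+q<r+s (+-mono-≤ (≮⇒≥ p≮r) (≮⇒≥ q≮s))) (<-irrefl refl)

inclMin⇒Dflip⊆component : {G : Graph n} {ω : Weight n} {k : ℕ} {χ χ' : Coloring n c} {u : Fin n} →
  InclMinImprovingFlip G ω k χ χ' → u ∈ Dflip χ χ' →
  Dflip χ χ' ⊆ component G (Dflip χ χ') u
inclMin⇒Dflip⊆component {n} {G = G} {ω} {k} {χ} {χ'} {u} ((dflip≤k , χ<χ') , minimal) u∈D {v} v∈D =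
  decidable-stable (v ∈? R) v∉R-impossible
  where
  D = Dflip χ χ'
  R = component G D u
  W = cutWeight G ω

  split : W χ' + W χ ≡ W (flipOn R χ χ') + W (flipOn (∁ R) χ χ')
  split = cutWeight-flipOn-split G ω R (component-separated G D u)

  improving : (S : Subset n) → W χ < W (flipOn S χ χ') →
              ImprovingNeighbor G ω k χ (flipOn S χ χ')
  improving S χ<χS = ≤-trans (dflip-flipOn-≤ {S = S}) dflip≤k , χ<χS

  v∉R-impossible : ¬ v ∉ R
  v∉R-impossible v∉R with +-<⇒<⊎< (subst (W χ + W χ <_) split (+-monoˡ-< (W χ) χ<χ'))
  ... | inj₁ χ<χR    = minimal _ (improving R χ<χR) (Dflip-flipOn-⊂ v∈D v∉R)
  ... | inj₂ χ<χD∖R = minimal _ (improving (∁ R) χ<χD∖R)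
                                (Dflip-flipOn-⊂ u∈D (x∈p⇒x∉∁p (u∈component G D u)))

lemma3 : (n c : ℕ) (G : Graph n) (ω : Weight n) (χ : Coloring n c) (k : ℕ)
         (χ' : Coloring n c) →
         InclMinImprovingFlip G ω k χ χ' →
         InducesConnected G (Dflip χ χ')
lemma3 n c G ω χ k χ' minimal u v u∈D v∈D =
  proj₂ (component-reachable G (Dflip χ χ') u u∈D
          (inclMin⇒Dflip⊆component {G = G} {ω} minimal u∈D v∈D))
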